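{- Let $G$ be a graph without isolated vertices and let $k$ be a positive integer. Then $G$ is a total $k$-uniform chordal graph if and only if $k$ is even and $G$ is the disjoint union of exactly $k/2$ complete multipartite graphs (each with at least two parts), in each of which at most one part has size greater than 1.
   Context: All graphs are finite and simple. A graph is chordal if it has no induced cycle of length at least 4. A complete multipartite graph has its vertex set partitioned into parts, with two vertices adjacent iff they lie in different parts. $N(v)$ is the set of neighbors of $v$. For a graph $G$ with no isolated vertices, a total dominating set is a set $A\subseteq V(G)$ such that every vertex of $G$ has a neighbor in $A$; $\gamma_t(G)$ is the minimum size of one. A sequence $(v_1,\dots,v_m)$ of distinct vertices is legal if $N(v_i)\setminus\bigcup_{j=1}^{i-1}N(v_j)\neq\emptyset$ for every $i\in\{2,\dots,m\}$; it is a total dominating sequence if moreover $\{v_1,\dots,v_m\}$ is a total dominating set. $\gamma_{gr}^t(G)$ is the maximum length of a total dominating sequence. $G$ is total $k$-uniform if $\gamma_t(G)=\gamma_{gr}^t(G)=k$. -}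

module Defs where

open import Data.Nat using (ℕ; zero; suc; _+_; _*_; _≤_; _∸_)
open import Data.Fin using (Fin; toℕ)
open import Data.Bool using (Bool; true)
open import Data.List using (List; []; _∷_; _++_; [_]; length)
open import Data.List.Membership.Propositional using (_∈_)
open import Data.List.Relation.Unary.All using (All)
open import Data.List.Relation.Unary.Unique.Propositional using (Unique)
open import Data.Product using (Σ; ∃; ∃-syntax; _×_)
open import Data.Sum using (_⊎_)
open import Relation.Nullary using (¬_)
open import Relation.Binary.PropositionalEquality using (_≡_; _≢_)
open import Function.Definitions using (Injective)

record Graph (n : ℕ) : Set where
  field
    adj   : Fin n → Fin n → Bool
    sym   : ∀ u v → adj u v ≡ adj v u
    irrfl : ∀ v → adj v v ≢ true

module _ {n : ℕ} (G : Graph n) where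
  open Graph G

  Adj : Fin n → Fin n → Set
  Adj u v = adj u v ≡ true

  NoIsolated : Set
  NoIsolated = ∀ v → ∃[ u ] Adj v u

  Dominates : List (Fin n) → Set
  Dominates A = ∀ v → ∃[ u ] (u ∈ A × Adj v u)

  IsTDS : List (Fin n) → Set
  IsTDS A = Unique A × Dominates A

  -- legality: N(v_i) minus the union of N(v_j), j < i, is nonempty (for i ≥ 2);
  -- 'prev' is the list of earlier vertices.
  LegalFrom : List (Fin n) → List (Fin n) → Set
  LegalFrom prev [] = ⊤'
    where open import Data.Unit using () renaming (⊤ to ⊤')
  LegalFrom prev (v ∷ rest) =
    (prev ≡ [] ⊎ ∃[ w ] (Adj v w × All (λ u → ¬ Adj u w) prev))
    × LegalFrom (prev ++ [ v ]) rest

  Legal : List (Fin n) → Set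
  Legal s = Unique s × LegalFrom [] s

  IsTDSeq : List (Fin n) → Set
  IsTDSeq s = Legal s × Dominates s

  GammaT≡ : ℕ → Set
  GammaT≡ k = (∃[ A ] (IsTDS A × length A ≡ k))
            × (∀ A → IsTDS A → k ≤ length A)

  GammaGrT≡ : ℕ → Set
  GammaGrT≡ k = (∃[ s ] (IsTDSeq s × length s ≡ k))
              × (∀ s → IsTDSeq s → length s ≤ k)

  TotalUniform : ℕ → Set
  TotalUniform k = GammaT≡ k × GammaGrT≡ k

  CycConsec : (m : ℕ) → Fin m → Fin m → Set
  CycConsec m i j =
      toℕ j ≡ suc (toℕ i) ⊎ toℕ i ≡ suc (toℕ j)
    ⊎ (toℕ i ≡ 0 × toℕ j ≡ m ∸ 1) ⊎ (toℕ j ≡ 0 × toℕ i ≡ m ∸ 1)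

  InducedCycle : (m : ℕ) → (Fin m → Fin n) → Set
  InducedCycle m c = Injective _≡_ _≡_ c
    × (∀ i j → (Adj (c i) (c j) → CycConsec m i j) × (CycConsec m i j → Adj (c i) (c j)))

  Chordal : Set
  Chordal = ∀ m → 4 ≤ m → (c : Fin m → Fin n) → ¬ InducedCycle m c

  -- G is the disjoint union of exactly r complete multipartite graphs,
  -- each with at least two parts, in each of which at most one part has size > 1.
  -- comp assigns each vertex its component (every component nonempty),
  -- part labels the part within the component.
  UnionOfCMP : ℕ → Set
  UnionOfCMP r = Σ (Fin n → Fin r) λ comp → Σ (Fin n → ℕ) λ part →
      (∀ u v → (Adj u v → comp u ≡ comp v × part u ≢ part v)
             × (comp u ≡ comp v × part u ≢ part v → Adj u v))
    × (∀ i → ∃[ u ] ∃[ v ] (comp u ≡ i × comp v ≡ i × part u ≢ part v))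
    × (∀ u u' v v' → comp u ≡ comp v → comp u ≡ comp u' → comp v ≡ comp v'
         → part u ≡ part u' → u ≢ u' → part v ≡ part v' → v ≢ v'
         → part u ≡ part v)

-- Total uniformity yields a covering principle: if the neighbourhoods of the vertices of a
-- legal sequence P all lie within those of a set Q, then |P| ≤ |Q|.  In particular no legal
-- triple is covered by two vertices.  By Dirac's lemma every component
-- of a chordal graph has a simplicial vertex w; for a neighbour t of w the covering principle
-- makes N[t] the whole component, and makes non-adjacent vertices of a component have nested
-- neighbourhoods, so that two adjacent vertices with non-neighbours would span an induced C₄.
-- Hence each component is complete multipartite, its only part of size > 1 consisting of the
-- vertices with a non-neighbour.  Conversely, in such a union a total dominating set needs two
-- vertices per component, a legal sequence takes at most two from each (the earlier vertices of
-- a component all lie in the part of the undominated neighbour), and two adjacent vertices per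
-- component form a total dominating sequence: γₜ = γᵗ_gr = 2r.

module Submission where

open import Defs
open import Data.Bool using (true; false; if_then_else_)
open import Data.Bool.Properties using () renaming (_≟_ to _≟B_)
open import Data.Empty using (⊥; ⊥-elim)
open import Data.Fin using (Fin; toℕ) renaming (zero to fzero; suc to fsuc)
open import Data.Fin.Properties using (any?; toℕ<n; toℕ-injective) renaming (_≟_ to _≟F_)
open import Data.Fin.Subset using (Subset; ⁅_⁆; _∪_; ∣_∣; _⊆_; _⊂_) renaming (_∈_ to _∈ₛ_; _∉_ to _∉ₛ_; ⊤ to ⊤ₛ)
open import Data.Fin.Subset.Induction using (⊂-wellFounded; Acc; acc)
open import Data.Fin.Subset.Properties using (x∈⁅x⁆; x∈⁅y⁆⇒x≡y; ∣⁅x⁆∣≡1; ∣p∣≤n; p⊂q⇒∣p∣<∣q∣; p⊆p∪q; x∈p∪q⁺; x∈p∪q⁻; ∈⊤) renaming (_∈?_ to _∈ₛ?_)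
open import Data.List using (List; []; _∷_; _++_; [_]; length; filter; allFin)
open import Data.List.Membership.Propositional using (_∈_; _∉_)
open import Data.List.Membership.Propositional.Properties using (∈-++⁺ˡ; ∈-++⁺ʳ; ∈-++⁻; ∈-filter⁺; ∈-filter⁻; ∈-allFin)
open import Data.List.Properties using (++-assoc; ++-identityʳ; length-++; length-filter; filter-++; length-tabulate)
open import Data.List.Relation.Unary.All as All using (All; []; _∷_)
open import Data.List.Relation.Unary.All.Properties using () renaming (++⁺ to All-++⁺)
open import Data.List.Relation.Unary.AllPairs using ([]; _∷_)
open import Data.List.Relation.Unary.Any using (here; there)
open import Data.List.Relation.Unary.Unique.Propositional using (Unique)
open import Data.List.Relation.Unary.Unique.Propositional.Properties using (++⁺; filter⁺; allFin⁺)
open import Data.Nat using (ℕ; zero; suc; _+_; _*_; _≤_; _<_; _%_; _/_; z≤n; s≤s; _≟_)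
open import Data.Nat.DivMod using (m*n%n≡0; m*n/n≡m; m≡m%n+[m/n]*n)
open import Data.Nat.Properties using (≤-antisym; ≤-trans; ≤-refl; ≤-reflexive; +-cancelʳ-≤; +-monoʳ-≤; +-mono-≤; n≤1+n; m≤n⇒m<n∨m≡n; <-irrefl; 1+n≰n; <-cmp; ≰⇒>; _≤?_; +-0-commutativeMonoid; module ≤-Reasoning)
open import Data.Product using (Σ; ∃-syntax; _×_; _,_; proj₁; proj₂)
open import Data.Sum using (_⊎_; inj₁; inj₂)
open import Data.Unit using (⊤; tt)
open import Data.Vec using (tabulate)
open import Data.Vec.Properties using (lookup∘tabulate; []=⇒lookup; lookup⇒[]=)
open import Function.Bundles using (_⇔_; mk⇔)
open import Relation.Binary.Definitions using (tri<; tri≈; tri>)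
open import Relation.Binary.PropositionalEquality using (_≡_; _≢_; refl; sym; trans; cong; subst; subst₂; module ≡-Reasoning)
open import Relation.Nullary using (¬_; Dec; does; yes; no; ¬?)
open import Relation.Nullary.Decidable using (_×-dec_; _⊎-dec_; dec-true; decidable-stable)
open import Relation.Unary using (Decidable)

open import Algebra.Properties.CommutativeMonoid.Sum +-0-commutativeMonoid using (sum; sum-cong-≗; ∑-distrib-+; sum-replicate-zero)

Unique-∷ʳ : ∀ {a} {A : Set a} {xs : List A} {x} → Unique xs → x ∉ xs → Unique (xs ++ [ x ])
Unique-∷ʳ {xs = xs} {x} xs! x∉xs = ++⁺ xs! ([] ∷ []) λ { (x∈xs , here refl) → x∉xs x∈xs }

Unique-++⁻ʳ : ∀ {a} {A : Set a} (xs : List A) {ys} → Unique (xs ++ ys) → Unique ys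
Unique-++⁻ʳ []       ys! = ys!
Unique-++⁻ʳ (_ ∷ xs) (_ ∷ xs++ys!) = Unique-++⁻ʳ xs xs++ys!

two-distinct⇒2≤length : ∀ {a} {A : Set a} {x y : A} (xs : List A) → x ∈ xs → y ∈ xs → x ≢ y → 2 ≤ length xs
two-distinct⇒2≤length (_ ∷ _)     (here refl) (here refl) x≢y = ⊥-elim (x≢y refl)
two-distinct⇒2≤length (_ ∷ _ ∷ _) (here refl) (there _)   _   = s≤s (s≤s z≤n)
two-distinct⇒2≤length (_ ∷ _ ∷ _) (there _)   (here refl) _   = s≤s (s≤s z≤n)
two-distinct⇒2≤length (_ ∷ xs)    (there x∈)  (there y∈)  x≢y = ≤-trans (two-distinct⇒2≤length xs x∈ y∈ x≢y) (n≤1+n _)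

extendAfter : ∀ {a} {A : Set a} → (ℕ → A) → ℕ → A → ℕ → A
extendAfter q i x k with k ≤? i
... | yes _ = q k
... | no _  = x

extendAfter-≤ : ∀ {a} {A : Set a} (q : ℕ → A) {i x k} → k ≤ i → extendAfter q i x k ≡ q k
extendAfter-≤ q {i} {x} {k} k≤i with k ≤? i
... | yes _ = refl
... | no k≰i = ⊥-elim (k≰i k≤i)

extendAfter-suc : ∀ {a} {A : Set a} (q : ℕ → A) i {x} → extendAfter q i x (suc i) ≡ x
extendAfter-suc q i with suc i ≤? i
... | yes 1+i≤i = ⊥-elim (<-irrefl refl 1+i≤i)
... | no _ = refl

sum-mono-≤ : ∀ {r} (f g : Fin r → ℕ) → (∀ i → f i ≤ g i) → sum f ≤ sum g
sum-mono-≤ {zero}  f g f≤g = z≤n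
sum-mono-≤ {suc r} f g f≤g = +-mono-≤ (f≤g fzero) (sum-mono-≤ (λ i → f (fsuc i)) (λ i → g (fsuc i)) (λ i → f≤g (fsuc i)))

sum-const : ∀ r m → sum {r} (λ _ → m) ≡ r * m
sum-const zero    m = refl
sum-const (suc r) m = cong (m +_) (sum-const r m)

indicator : ∀ {r} → Fin r → Fin r → ℕ
indicator j i = if does (j ≟F i) then 1 else 0

sum-indicator : ∀ {r} (j : Fin r) → sum (indicator j) ≡ 1
sum-indicator {suc r} fzero    = cong suc (sum-replicate-zero r)
sum-indicator {suc r} (fsuc j) = sum-indicator j

module FibreCounting {a} {A : Set a} {r : ℕ} (f : A → Fin r) where

  fibre : Fin r → List A → List A
  fibre i = filter (λ x → f x ≟F i)

  length-fibre-∷ : ∀ x xs i → length (fibre i (x ∷ xs)) ≡ indicator (f x) i + length (fibre i xs)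
  length-fibre-∷ x xs i with does (f x ≟F i)
  ... | true  = refl
  ... | false = refl

  length≡∑fibres : ∀ xs → length xs ≡ sum (λ i → length (fibre i xs))
  length≡∑fibres []       = sym (sum-replicate-zero r)
  length≡∑fibres (x ∷ xs) = begin
    suc (length xs)                                           ≡⟨ cong suc (length≡∑fibres xs) ⟩
    1 + sum (λ i → length (fibre i xs))                       ≡⟨ cong (_+ _) (sum-indicator (f x)) ⟨
    sum (indicator (f x)) + sum (λ i → length (fibre i xs))   ≡⟨ ∑-distrib-+ (indicator (f x)) _ ⟨
    sum (λ i → indicator (f x) i + length (fibre i xs))       ≡⟨ sum-cong-≗ (λ i → sym (length-fibre-∷ x xs i)) ⟩
    sum (λ i → length (fibre i (x ∷ xs)))                     ∎
    where open ≡-Reasoning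

  length≤ : ∀ {m} xs → (∀ i → length (fibre i xs) ≤ m) → length xs ≤ r * m
  length≤ {m} xs bounded = begin
    length xs                              ≡⟨ length≡∑fibres xs ⟩
    sum (λ i → length (fibre i xs))        ≤⟨ sum-mono-≤ _ _ bounded ⟩
    sum {r} (λ _ → m)                      ≡⟨ sum-const r m ⟩
    r * m                                  ∎
    where open ≤-Reasoning

  ≤length : ∀ {m} xs → (∀ i → m ≤ length (fibre i xs)) → r * m ≤ length xs
  ≤length {m} xs bounded = begin
    r * m                                  ≡⟨ sum-const r m ⟨
    sum {r} (λ _ → m)                      ≤⟨ sum-mono-≤ _ _ bounded ⟩
    sum (λ i → length (fibre i xs))        ≡⟨ length≡∑fibres xs ⟨
    length xs                              ∎
    where open ≤-Reasoning

  two-in-fibre : ∀ {x y i} xs → x ∈ xs → y ∈ xs → f x ≡ i → f y ≡ i → x ≢ y → 2 ≤ length (fibre i xs)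
  two-in-fibre {i = i} xs x∈ y∈ fx≡i fy≡i x≢y =
    two-distinct⇒2≤length (fibre i xs) (∈-filter⁺ (λ x → f x ≟F i) x∈ fx≡i) (∈-filter⁺ (λ x → f x ≟F i) y∈ fy≡i) x≢y

⟦_⟧ : ∀ {m} {P : Fin m → Set} → Decidable P → Subset m
⟦ P? ⟧ = tabulate (λ x → does (P? x))

∈⟦⟧⁺ : ∀ {m} {P : Fin m → Set} (P? : Decidable P) {x} → P x → x ∈ₛ ⟦ P? ⟧
∈⟦⟧⁺ P? {x} px = lookup⇒[]= x _ (trans (lookup∘tabulate _ x) (dec-true (P? x) px))

∈⟦⟧⁻ : ∀ {m} {P : Fin m → Set} (P? : Decidable P) {x} → x ∈ₛ ⟦ P? ⟧ → P x
∈⟦⟧⁻ P? {x} x∈ with P? x | trans (sym (lookup∘tabulate _ x)) ([]=⇒lookup x∈)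
... | yes px | _ = px

module Neighbourhoods {n : ℕ} (G : Graph n) where

  open Graph G using (adj; irrfl) renaming (sym to adj-sym)

  infix 4 _~_

  _~_ : Fin n → Fin n → Set
  u ~ v = Adj G u v

  _~?_ : (u v : Fin n) → Dec (u ~ v)
  u ~? v = adj u v ≟B true

  ~-sym : ∀ {u v} → u ~ v → v ~ u
  ~-sym {u} {v} u~v = trans (adj-sym v u) u~v

  ~-irrefl : ∀ {v} → ¬ v ~ v
  ~-irrefl {v} = irrfl v

  ~⇒≢ : ∀ {u v} → u ~ v → u ≢ v
  ~⇒≢ u~u refl = ~-irrefl u~u

  N[_] : Fin n → Fin n → Set
  N[ t ] x = x ≡ t ⊎ t ~ x

  N[_]? : ∀ t x → Dec (N[ t ] x)
  N[ t ]? x = (x ≟F t) ⊎-dec (t ~? x)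

  ∉N[] : ∀ {u v} → v ≢ u → ¬ u ~ v → ¬ N[ u ] v
  ∉N[] v≢u _   (inj₁ v≡u) = v≢u v≡u
  ∉N[] _   u≁v (inj₂ u~v) = u≁v u~v

  N[]-nonadjacent⇒centre~ : ∀ {t u v} → N[ t ] u → N[ t ] v → ¬ N[ u ] v → t ~ u
  N[]-nonadjacent⇒centre~ (inj₂ t~u)  _           _       = t~u
  N[]-nonadjacent⇒centre~ (inj₁ refl) (inj₁ refl) v∉N[u] = ⊥-elim (v∉N[u] (inj₁ refl))
  N[]-nonadjacent⇒centre~ (inj₁ refl) (inj₂ t~v)  v∉N[u] = ⊥-elim (v∉N[u] (inj₂ t~v))

  N[]-sym : ∀ {u v} → N[ u ] v → N[ v ] u
  N[]-sym (inj₁ refl) = inj₁ refl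
  N[]-sym (inj₂ u~v) = inj₂ (~-sym u~v)

  AdjClosed : (Fin n → Set) → Set
  AdjClosed Z = ∀ {x y} → Z x → x ~ y → Z y

  closed⇒N[]⊆ : ∀ {Z t} → AdjClosed Z → Z t → ∀ {v} → N[ t ] v → Z v
  closed⇒N[]⊆ closed Zt (inj₁ refl) = Zt
  closed⇒N[]⊆ closed Zt (inj₂ t~v) = closed Zt t~v

  overlap⇒N[]⊆ : ∀ {t t′ x} → AdjClosed N[ t′ ] → N[ t ] x → N[ t′ ] x → ∀ {v} → N[ t ] v → N[ t′ ] v
  overlap⇒N[]⊆ closed (inj₁ refl) x∈N[t′] = closed⇒N[]⊆ closed x∈N[t′]
  overlap⇒N[]⊆ closed (inj₂ t~x) x∈N[t′] = closed⇒N[]⊆ closed (closed x∈N[t′] (~-sym t~x))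

  Simplicial : Fin n → Set
  Simplicial w = ∀ {x y} → w ~ x → w ~ y → x ≢ y → x ~ y

  HasNeighbourIn : List (Fin n) → Fin n → Set
  HasNeighbourIn L x = ∃[ u ] (u ∈ L × x ~ u)

module Legality {n : ℕ} (G : Graph n) where

  open Neighbourhoods G
  open import Data.List.Membership.DecPropositional (_≟F_ {n}) using (_∈?_)

  LegalStep : List (Fin n) → Fin n → Set
  LegalStep prev v = prev ≡ [] ⊎ ∃[ w ] (v ~ w × All (λ u → ¬ u ~ w) prev)

  LegalFrom-∷ʳ : ∀ prev xs {u} → LegalFrom G prev xs → LegalStep (prev ++ xs) u →
                 LegalFrom G prev (xs ++ [ u ])
  LegalFrom-∷ʳ prev []       _          step = subst (λ p → LegalStep p _) (++-identityʳ prev) step , tt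
  LegalFrom-∷ʳ prev (x ∷ xs) (step₁ , l) step =
    step₁ , LegalFrom-∷ʳ (prev ++ [ x ]) xs l (subst (λ p → LegalStep p _) (sym (++-assoc prev [ x ] xs)) step)

  legal-∷ʳ : ∀ {s u w} → Legal G s → u ∉ s → u ~ w → All (λ y → ¬ y ~ w) s → Legal G (s ++ [ u ])
  legal-∷ʳ {s} (s! , l) u∉s u~w w-new = Unique-∷ʳ s! u∉s , LegalFrom-∷ʳ [] s l (inj₂ (_ , u~w , w-new))

  -- For each v in vs not yet dominated append a neighbour u of v; u is legal since
  -- v is a neighbour of u but of no earlier vertex.
  extend-legal : NoIsolated G → (vs s : List (Fin n)) → Legal G s →
                 ∃[ R ] (Legal G (s ++ R) × All (HasNeighbourIn (s ++ R)) vs)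
  extend-legal ni []       s l = [] , subst (Legal G) (sym (++-identityʳ s)) l , []
  extend-legal ni (v ∷ vs) s l with any? (λ u → (u ∈? s) ×-dec (v ~? u))
  ... | yes (u , u∈s , v~u) =
    let R , l′ , dom = extend-legal ni vs s l in
    R , l′ , (u , ∈-++⁺ˡ u∈s , v~u) ∷ dom
  ... | no v-undominated =
    let u , v~u = ni v
        l₁ = legal-∷ʳ l (λ u∈s → v-undominated (u , u∈s , v~u)) (~-sym v~u)
                      (All.tabulate λ y∈s y~v → v-undominated (_ , y∈s , ~-sym y~v))
        R , l′ , dom = extend-legal ni vs (s ++ [ u ]) l₁
    in u ∷ R ,
       subst (λ s′ → Legal G s′ × All (HasNeighbourIn s′) (v ∷ vs)) (++-assoc s [ u ] R)
             (l′ , (u , ∈-++⁺ˡ (∈-++⁺ʳ s (here refl)) , v~u) ∷ dom)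

  extend-to-TDSeq : NoIsolated G → ∀ s → Legal G s → ∃[ R ] IsTDSeq G (s ++ R)
  extend-to-TDSeq ni s l =
    let R , l′ , dom = extend-legal ni (allFin n) s l in
    R , l′ , λ v → All.lookup dom (∈-allFin v)

GammaT-unique : ∀ {n} {G : Graph n} {k m} → GammaT≡ G k → GammaT≡ G m → k ≡ m
GammaT-unique ((A , A-tds , ∣A∣≡k) , k-min) ((B , B-tds , ∣B∣≡m) , m-min) =
  ≤-antisym (≤-trans (k-min B B-tds) (≤-reflexive ∣B∣≡m))
            (≤-trans (m-min A A-tds) (≤-reflexive ∣A∣≡k))

module TotalUniformity {n : ℕ} (G : Graph n) {k : ℕ} (tu : TotalUniform G k) (ni : NoIsolated G) where

  open Neighbourhoods G
  open Legality G
  open import Data.List.Membership.DecPropositional (_≟F_ {n}) using (_∈?_)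

  -- Extend P by R to a total dominating sequence; then Q together with the vertices of R
  -- outside Q is a total dominating set, so |P| + |R| ≤ k ≤ |Q| + |R|.
  legal≤covering : ∀ P Q → Legal G P → Unique Q → (∀ {x} → HasNeighbourIn P x → HasNeighbourIn Q x) →
                   length P ≤ length Q
  legal≤covering P Q P-legal Q! covers with extend-to-TDSeq ni P P-legal
  ... | R , P++R-seq = +-cancelʳ-≤ (length R) (length P) (length Q) (begin
      length P + length R   ≡⟨ length-++ P ⟨
      length (P ++ R)       ≤⟨ proj₂ (proj₂ tu) (P ++ R) P++R-seq ⟩
      k                     ≤⟨ proj₂ (proj₁ tu) (Q ++ R′) (QR′! , QR′-dom) ⟩
      length (Q ++ R′)      ≡⟨ length-++ Q ⟩
      length Q + length R′  ≤⟨ +-monoʳ-≤ (length Q) (length-filter ∉Q? R) ⟩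
      length Q + length R   ∎)
    where
    open ≤-Reasoning
    ∉Q? : ∀ y → Dec (y ∉ Q)
    ∉Q? y = ¬? (y ∈? Q)
    R′ : List (Fin n)
    R′ = filter ∉Q? R
    QR′! : Unique (Q ++ R′)
    QR′! = ++⁺ Q! (filter⁺ ∉Q? (Unique-++⁻ʳ P (proj₁ (proj₁ P++R-seq))))
               (λ (y∈Q , y∈R′) → proj₂ (∈-filter⁻ ∉Q? {xs = R} y∈R′) y∈Q)
    QR′-dom : Dominates G (Q ++ R′)
    QR′-dom v with proj₂ P++R-seq v
    ... | u , u∈P++R , v~u with ∈-++⁻ P u∈P++R | u ∈? Q
    ...   | inj₁ u∈P | _ = let q , q∈Q , v~q = covers (u , u∈P , v~u) in q , ∈-++⁺ˡ q∈Q , v~q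
    ...   | inj₂ u∈R | yes u∈Q = u , ∈-++⁺ˡ u∈Q , v~u
    ...   | inj₂ u∈R | no u∉Q = u , ∈-++⁺ʳ Q (∈-filter⁺ ∉Q? u∈R u∉Q) , v~u

  legal-triple : ∀ {p q r} → p ≢ q → p ≢ r → q ≢ r →
                 ∃[ w ] (q ~ w × ¬ p ~ w) → ∃[ w ] (r ~ w × ¬ p ~ w × ¬ q ~ w) →
                 Legal G (p ∷ q ∷ r ∷ [])
  legal-triple p≢q p≢r q≢r (w , q~w , p≁w) (w′ , r~w′ , p≁w′ , q≁w′) =
    ((p≢q ∷ p≢r ∷ []) ∷ (q≢r ∷ []) ∷ [] ∷ []) ,
    inj₁ refl , inj₂ (w , q~w , p≁w ∷ []) , inj₂ (w′ , r~w′ , p≁w′ ∷ q≁w′ ∷ []) , tt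

  no-legal-triple-covered-by-pair :
    ∀ {p q r x y} → Legal G (p ∷ q ∷ r ∷ []) → x ≢ y →
    (∀ {z} → z ~ p ⊎ z ~ q ⊎ z ~ r → z ~ x ⊎ z ~ y) → ⊥
  no-legal-triple-covered-by-pair {p} {q} {r} {x} {y} legal x≢y covers =
    1+n≰n (legal≤covering (p ∷ q ∷ r ∷ []) (x ∷ y ∷ []) legal ((x≢y ∷ []) ∷ [] ∷ []) covers′)
    where
    into-pair : ∀ {z} → z ~ x ⊎ z ~ y → HasNeighbourIn (x ∷ y ∷ []) z
    into-pair (inj₁ z~x) = x , here refl , z~x
    into-pair (inj₂ z~y) = y , there (here refl) , z~y
    covers′ : ∀ {z} → HasNeighbourIn (p ∷ q ∷ r ∷ []) z → HasNeighbourIn (x ∷ y ∷ []) z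
    covers′ (_ , here refl , z~p)                 = into-pair (covers (inj₁ z~p))
    covers′ (_ , there (here refl) , z~q)         = into-pair (covers (inj₂ (inj₁ z~q)))
    covers′ (_ , there (there (here refl)) , z~r) = into-pair (covers (inj₂ (inj₂ z~r)))

  -- Otherwise some x ~ t has a neighbour y ∉ N[t]; then (w , t , x) is legal, and since
  -- N(w) ⊆ N[t] every neighbour of w, t or x is a neighbour of t or of x.
  simplicial-neighbour-closed : ∀ {w t} → Simplicial w → w ~ t → AdjClosed N[ t ]
  simplicial-neighbour-closed sw w~t (inj₁ refl) x~y = inj₂ x~y
  simplicial-neighbour-closed {w} {t} sw w~t {x} {y} (inj₂ t~x) x~y with N[ t ]? y
  ... | yes y∈N[t] = y∈N[t]
  ... | no y∉N[t] = ⊥-elim (no-legal-triple-covered-by-pair legal (~⇒≢ t~x) covers)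
    where
    t≁y : ¬ t ~ y
    t≁y t~y = y∉N[t] (inj₂ t~y)
    w≁y : ¬ w ~ y
    w≁y w~y = t≁y (sw w~t w~y λ t≡y → y∉N[t] (inj₁ (sym t≡y)))
    legal : Legal G (w ∷ t ∷ x ∷ [])
    legal = legal-triple (~⇒≢ w~t) (λ { refl → w≁y x~y }) (~⇒≢ t~x)
              (w , ~-sym w~t , ~-irrefl) (y , x~y , w≁y , t≁y)
    covers : ∀ {z} → z ~ w ⊎ z ~ t ⊎ z ~ x → z ~ t ⊎ z ~ x
    covers {z} (inj₁ z~w) with z ≟F t
    ... | yes refl = inj₂ t~x
    ... | no z≢t = inj₁ (~-sym (sw w~t (~-sym z~w) λ t≡z → z≢t (sym t≡z)))
    covers (inj₂ z~t∨x) = z~t∨x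

  -- Otherwise (v , u , x) with x ∉ N(v) is legal while all of its neighbourhoods lie in N(t) ∪ N(u).
  nonadjacent-nested : ∀ {t u v} → AdjClosed N[ t ] → N[ t ] u → N[ t ] v → ¬ N[ u ] v →
                       ∀ {x} → u ~ x → v ~ x
  nonadjacent-nested {t} {u} {v} closed u∈N[t] v∈N[t] v∉N[u] {x} u~x with v ~? x
  ... | yes v~x = v~x
  ... | no v≁x = ⊥-elim (no-legal-triple-covered-by-pair legal (~⇒≢ t~u) covers)
    where
    t~u : t ~ u
    t~u = N[]-nonadjacent⇒centre~ u∈N[t] v∈N[t] v∉N[u]
    legal : Legal G (v ∷ u ∷ x ∷ [])
    legal = legal-triple (λ v≡u → v∉N[u] (inj₁ v≡u)) (λ { refl → v∉N[u] (inj₂ u~x) }) (~⇒≢ u~x)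
              (x , u~x , v≁x) (u , ~-sym u~x , (λ v~u → v∉N[u] (inj₂ (~-sym v~u))) , ~-irrefl)
    toward-t : ∀ {z y} → N[ t ] y → z ~ y → z ~ t ⊎ z ~ u
    toward-t y∈N[t] z~y with closed y∈N[t] (~-sym z~y)
    ... | inj₁ refl = inj₂ t~u
    ... | inj₂ t~z = inj₁ (~-sym t~z)
    covers : ∀ {z} → z ~ v ⊎ z ~ u ⊎ z ~ x → z ~ t ⊎ z ~ u
    covers (inj₁ z~v)          = toward-t v∈N[t] z~v
    covers (inj₂ (inj₁ z~u))   = inj₂ z~u
    covers (inj₂ (inj₂ z~x))   = toward-t (closed u∈N[t] u~x) z~x

module Connectivity {n : ℕ} (G : Graph n) where

  open Neighbourhoods G

  Frontier : Subset n → Subset n → Fin n → Set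
  Frontier Y L x = x ∈ₛ Y × ∃[ y ] (y ∈ₛ L × y ~ x)

  frontier? : ∀ Y L → Decidable (Frontier Y L)
  frontier? Y L x = (x ∈ₛ? Y) ×-dec any? (λ y → (y ∈ₛ? L) ×-dec (y ~? x))

  layer : Subset n → Fin n → ℕ → Subset n
  layer Y s zero    = ⁅ s ⁆
  layer Y s (suc i) = layer Y s i ∪ ⟦ frontier? Y (layer Y s i) ⟧

  -- the vertices joined to s by a walk all of whose later vertices lie in Y
  reach : Subset n → Fin n → Subset n
  reach Y s = layer Y s n

  module Layers {Y : Subset n} {s : Fin n} where

    layer-⊆suc : ∀ i → layer Y s i ⊆ layer Y s (suc i)
    layer-⊆suc i = p⊆p∪q _

    layer-mono : ∀ {i} j → i ≤ j → layer Y s i ⊆ layer Y s j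
    layer-mono zero    z≤n = λ x∈ → x∈
    layer-mono (suc j) i≤j with m≤n⇒m<n∨m≡n i≤j
    ... | inj₁ (s≤s i≤j′) = λ x∈ → layer-⊆suc j (layer-mono j i≤j′ x∈)
    ... | inj₂ refl = λ x∈ → x∈

    layer-step : ∀ i {x y} → y ∈ₛ layer Y s i → x ∈ₛ Y → y ~ x → x ∈ₛ layer Y s (suc i)
    layer-step i y∈ x∈Y y~x = x∈p∪q⁺ (inj₂ (∈⟦⟧⁺ (frontier? Y (layer Y s i)) (x∈Y , _ , y∈ , y~x)))

    layer-suc⁻ : ∀ i {x} → x ∈ₛ layer Y s (suc i) → x ∈ₛ layer Y s i ⊎ Frontier Y (layer Y s i) x
    layer-suc⁻ i x∈ with x∈p∪q⁻ (layer Y s i) _ x∈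
    ... | inj₁ x∈Lᵢ = inj₁ x∈Lᵢ
    ... | inj₂ x∈new = inj₂ (∈⟦⟧⁻ (frontier? Y (layer Y s i)) x∈new)

    layer-ind : (Z : Fin n → Set) → Z s → (∀ {y x} → Z y → x ∈ₛ Y → y ~ x → Z x) →
                ∀ i {x} → x ∈ₛ layer Y s i → Z x
    layer-ind Z Zs step zero    x∈ = subst Z (sym (x∈⁅y⁆⇒x≡y s x∈)) Zs
    layer-ind Z Zs step (suc i) x∈ with layer-suc⁻ i x∈
    ... | inj₁ x∈Lᵢ = layer-ind Z Zs step i x∈Lᵢ
    ... | inj₂ (x∈Y , y , y∈Lᵢ , y~x) = step (layer-ind Z Zs step i y∈Lᵢ) x∈Y y~x

    Stable : ℕ → Set
    Stable i = layer Y s (suc i) ⊆ layer Y s i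

    stable-suc : ∀ {i} → Stable i → Stable (suc i)
    stable-suc {i} stable x∈ with layer-suc⁻ (suc i) x∈
    ... | inj₁ x∈ = x∈
    ... | inj₂ (x∈Y , y , y∈ , y~x) = layer-step i (stable y∈) x∈Y y~x

    stable-mono : ∀ {i} j → i ≤ j → Stable i → Stable j
    stable-mono zero    z≤n stable = stable
    stable-mono (suc j) i≤j stable with m≤n⇒m<n∨m≡n i≤j
    ... | inj₁ (s≤s i≤j′) = stable-suc {j} (stable-mono j i≤j′ stable)
    ... | inj₂ refl = stable

    stable-or-grows : ∀ i → Stable i ⊎ layer Y s i ⊂ layer Y s (suc i)
    stable-or-grows i with any? (λ x → (x ∈ₛ? layer Y s (suc i)) ×-dec ¬? (x ∈ₛ? layer Y s i))
    ... | yes (x , x∈ , x∉) = inj₂ (layer-⊆suc i , x , x∈ , x∉)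
    ... | no none = inj₁ λ {x} x∈ → decidable-stable (x ∈ₛ? layer Y s i) λ x∉ → none (x , x∈ , x∉)

    -- while the layers grow, layer i has more than i of the n vertices
    stable-within : ∀ i → (∃[ j ] (j ≤ i × Stable j)) ⊎ i < ∣ layer Y s i ∣
    stable-within zero = inj₂ (≤-reflexive (sym (∣⁅x⁆∣≡1 s)))
    stable-within (suc i) with stable-within i | stable-or-grows i
    ... | inj₁ (j , j≤i , stable) | _ = inj₁ (j , ≤-trans j≤i (n≤1+n i) , stable)
    ... | inj₂ _   | inj₁ stable = inj₁ (i , n≤1+n i , stable)
    ... | inj₂ i<∣Lᵢ∣ | inj₂ Lᵢ⊂Lᵢ₊₁ = inj₂ (≤-trans (s≤s i<∣Lᵢ∣) (p⊂q⇒∣p∣<∣q∣ Lᵢ⊂Lᵢ₊₁))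

    stable-n : Stable n
    stable-n with stable-within n
    ... | inj₁ (j , j≤n , stable) = stable-mono n j≤n stable
    ... | inj₂ n<∣Lₙ∣ = ⊥-elim (<-irrefl refl (≤-trans n<∣Lₙ∣ (∣p∣≤n (layer Y s n))))

    Exact : ℕ → Fin n → Set
    Exact zero    x = x ≡ s
    Exact (suc i) x = x ∈ₛ layer Y s (suc i) × x ∉ₛ layer Y s i

    exact⇒layer : ∀ i {x} → Exact i x → x ∈ₛ layer Y s i
    exact⇒layer zero    refl     = x∈⁅x⁆ s
    exact⇒layer (suc i) (x∈ , _) = x∈

    layer⇒exact : ∀ i {x} → x ∈ₛ layer Y s i → ∃[ j ] (j ≤ i × Exact j x)
    layer⇒exact zero    x∈ = 0 , z≤n , x∈⁅y⁆⇒x≡y s x∈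
    layer⇒exact (suc i) {x} x∈ with x ∈ₛ? layer Y s i
    ... | yes x∈Lᵢ = let j , j≤i , exact = layer⇒exact i x∈Lᵢ in j , ≤-trans j≤i (n≤1+n i) , exact
    ... | no x∉Lᵢ = suc i , ≤-refl , x∈ , x∉Lᵢ

    exact-below : ∀ {i j x} → Exact j x → i < j → x ∉ₛ layer Y s i
    exact-below {j = suc j} (_ , x∉Lⱼ) (s≤s i≤j) x∈Lᵢ = x∉Lⱼ (layer-mono j i≤j x∈Lᵢ)

    exact-injective : ∀ {i j x} → Exact i x → Exact j x → i ≡ j
    exact-injective {i} {j} exactᵢ exactⱼ with <-cmp i j
    ... | tri< i<j _ _ = ⊥-elim (exact-below exactⱼ i<j (exact⇒layer i exactᵢ))
    ... | tri≈ _ i≡j _ = i≡j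
    ... | tri> _ _ j<i = ⊥-elim (exact-below exactᵢ j<i (exact⇒layer j exactⱼ))

    exact-∈Y : ∀ {i x} → Exact (suc i) x → x ∈ₛ Y
    exact-∈Y {i} (x∈ , x∉) with layer-suc⁻ i x∈
    ... | inj₁ x∈Lᵢ = ⊥-elim (x∉ x∈Lᵢ)
    ... | inj₂ (x∈Y , _) = x∈Y

    exact-pred : ∀ {i x} → Exact (suc i) x → ∃[ y ] (Exact i y × y ~ x)
    exact-pred {i} (x∈ , x∉) with layer-suc⁻ i x∈
    exact-pred {i}     (x∈ , x∉) | inj₁ x∈Lᵢ = ⊥-elim (x∉ x∈Lᵢ)
    exact-pred {zero}  (x∈ , x∉) | inj₂ (x∈Y , y , y∈L₀ , y~x) = y , x∈⁅y⁆⇒x≡y s y∈L₀ , y~x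
    exact-pred {suc i} (x∈ , x∉) | inj₂ (x∈Y , y , y∈ , y~x) =
      y , (y∈ , λ y∈Lᵢ → x∉ (layer-step i y∈Lᵢ x∈Y y~x)) , y~x

    exact-adjacent : ∀ {i j x y} → Exact i x → Exact j y → x ~ y → j ≤ suc i
    exact-adjacent {i} {zero}  _      _      _   = z≤n
    exact-adjacent {i} {suc j} exactₓ exact_y x~y with suc j ≤? suc i
    ... | yes j≤i = j≤i
    ... | no j≰i = ⊥-elim (exact-below exact_y (≰⇒> j≰i)
                             (layer-step i (exact⇒layer i exactₓ) (exact-∈Y {j} exact_y) x~y))

    -- a shortest walk from s, read off the exact layers backwards
    exact-path : ∀ i {x} → Exact i x →
                 Σ (ℕ → Fin n) λ q → q i ≡ x × (∀ {k} → k ≤ i → Exact k (q k)) × (∀ {k} → k < i → q k ~ q (suc k))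
    exact-path zero {x} refl = (λ _ → x) , refl , (λ { z≤n → refl }) , λ ()
    exact-path (suc i) {x} exact with exact-pred exact
    ... | y , exact_y , y~x with exact-path i exact_y
    ...   | q , qᵢ≡y , q-exact , q-edge = extendAfter q i x , extendAfter-suc q i , exact′ , edge′
      where
      exact′ : ∀ {k} → k ≤ suc i → Exact k (extendAfter q i x k)
      exact′ {k} k≤ with m≤n⇒m<n∨m≡n k≤
      ... | inj₁ (s≤s k≤i) = subst (Exact k) (sym (extendAfter-≤ q k≤i)) (q-exact k≤i)
      ... | inj₂ refl = subst (Exact (suc i)) (sym (extendAfter-suc q i)) exact
      edge′ : ∀ {k} → k < suc i → extendAfter q i x k ~ extendAfter q i x (suc k)
      edge′ {k} (s≤s k≤i) rewrite extendAfter-≤ q {x = x} k≤i with m≤n⇒m<n∨m≡n k≤i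
      ... | inj₁ k<i = subst (q k ~_) (sym (extendAfter-≤ q k<i)) (q-edge k<i)
      ... | inj₂ refl = subst₂ _~_ (sym qᵢ≡y) (sym (extendAfter-suc q k)) y~x

  open Layers public using (layer-mono; layer-step; layer-suc⁻)

  reach-seed : ∀ {Y s} → s ∈ₛ reach Y s
  reach-seed {Y} {s} = layer-mono {Y} n z≤n (x∈⁅x⁆ s)

  reach-closed : ∀ {Y s x y} → y ∈ₛ reach Y s → x ∈ₛ Y → y ~ x → x ∈ₛ reach Y s
  reach-closed {Y} {s} y∈ x∈Y y~x = Layers.stable-n {Y} {s} (layer-step n y∈ x∈Y y~x)

  reach-ind : ∀ {Y s} (Z : Fin n → Set) → Z s → (∀ {y x} → Z y → x ∈ₛ Y → y ~ x → Z x) →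
              ∀ {x} → x ∈ₛ reach Y s → Z x
  reach-ind {Y} {s} Z Zs step = Layers.layer-ind {Y} {s} Z Zs step n

  reach-⊆ : ∀ {Y s x} → x ∈ₛ reach Y s → x ≡ s ⊎ x ∈ₛ Y
  reach-⊆ {Y} {s} = reach-ind {Y} (λ x → x ≡ s ⊎ x ∈ₛ Y) (inj₁ refl) (λ _ x∈Y _ → inj₂ x∈Y)

  reach-⊆-closed : ∀ {Y s} {Z : Fin n → Set} → AdjClosed Z → Z s → ∀ {x} → x ∈ₛ reach Y s → Z x
  reach-⊆-closed {Y} {Z = Z} closed Zs = reach-ind {Y} Z Zs λ Zy _ y~x → closed Zy y~x

  reach-mono : ∀ {Y Y′ s} → Y ⊆ Y′ → reach Y s ⊆ reach Y′ s
  reach-mono {Y} {Y′} {s} Y⊆Y′ = reach-ind {Y} (_∈ₛ reach Y′ s) reach-seed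
                                   λ y∈ x∈Y y~x → reach-closed y∈ (Y⊆Y′ x∈Y) y~x

  reach-trans : ∀ {Y x y z} → y ∈ₛ reach Y x → z ∈ₛ reach Y y → z ∈ₛ reach Y x
  reach-trans {Y} {x} y∈ = reach-ind {Y} (_∈ₛ reach Y x) y∈ reach-closed

  reach-sym : ∀ {Y s x} → s ∈ₛ Y → x ∈ₛ reach Y s → s ∈ₛ reach Y x
  reach-sym {Y} {s} s∈Y x∈ = proj₂ (reach-ind {Y} (λ x → x ∈ₛ Y × s ∈ₛ reach Y x) (s∈Y , reach-seed)
    (λ (y∈Y , s∈Ry) x∈Y y~x → x∈Y , reach-trans (reach-closed reach-seed y∈Y (~-sym y~x)) s∈Ry) x∈)

  reach-self : ∀ {Y b} → reach Y b ⊆ reach (reach Y b) b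
  reach-self {Y} {b} x∈ = proj₂ (reach-ind {Y} (λ z → z ∈ₛ reach Y b × z ∈ₛ reach (reach Y b) b)
                                            (reach-seed , reach-seed) step x∈)
    where
    step : ∀ {y x} → y ∈ₛ reach Y b × y ∈ₛ reach (reach Y b) b → x ∈ₛ Y → y ~ x →
           x ∈ₛ reach Y b × x ∈ₛ reach (reach Y b) b
    step (y∈ , y∈′) x∈Y y~x = let x∈ = reach-closed y∈ x∈Y y~x in x∈ , reach-closed y∈′ x∈ y~x

  reach-connected : ∀ {Y b x y} → x ∈ₛ reach Y b → y ∈ₛ reach Y b → y ∈ₛ reach (reach Y b) x
  reach-connected x∈ y∈ = reach-trans (reach-sym reach-seed (reach-self x∈)) (reach-self y∈)

module Chordality {n : ℕ} (G : Graph n) (ch : Chordal G) where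

  open Neighbourhoods G
  open Connectivity G

  -- The apex a followed by q 0, …, q M is an induced cycle of length M + 2.
  no-apex-over-induced-path :
    ∀ M → 2 ≤ M → ∀ {a} (q : ℕ → Fin n) →
    (∀ {k l} → k ≤ M → l ≤ M → q k ≡ q l → k ≡ l) →
    (∀ {k l} → k ≤ M → l ≤ M → q k ~ q l → l ≡ suc k ⊎ k ≡ suc l) →
    (∀ {k} → k < M → q k ~ q (suc k)) →
    (∀ {k} → k ≤ M → q k ≢ a) →
    (∀ {k} → k ≤ M → a ~ q k → k ≡ 0 ⊎ k ≡ M) →
    a ~ q 0 → a ~ q M → ⊥
  no-apex-over-induced-path M 2≤M {a} q q-injective q-chordless q-edge q≢a a-ends a~q₀ a~q_M =
    ch (suc (suc M)) (s≤s (s≤s 2≤M)) (λ i → cyc (toℕ i))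
      ((λ {i} {j} eq → toℕ-injective (cyc-injective (toℕ<n i) (toℕ<n j) eq)) ,
       λ i j → adj⇒consec (toℕ<n i) (toℕ<n j) , consec⇒adj (toℕ<n i) (toℕ<n j))
    where
    cyc : ℕ → Fin n
    cyc zero    = a
    cyc (suc k) = q k

    Consec : ℕ → ℕ → Set
    Consec i j = j ≡ suc i ⊎ i ≡ suc j ⊎ (i ≡ 0 × j ≡ suc M) ⊎ (j ≡ 0 × i ≡ suc M)

    cyc-injective : ∀ {i j} → i < suc (suc M) → j < suc (suc M) → cyc i ≡ cyc j → i ≡ j
    cyc-injective {zero}  {zero}  _                _                eq = refl
    cyc-injective {zero}  {suc l} _                (s≤s (s≤s l≤M)) eq = ⊥-elim (q≢a l≤M (sym eq))
    cyc-injective {suc k} {zero}  (s≤s (s≤s k≤M)) _                eq = ⊥-elim (q≢a k≤M eq)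
    cyc-injective {suc k} {suc l} (s≤s (s≤s k≤M)) (s≤s (s≤s l≤M)) eq = cong suc (q-injective k≤M l≤M eq)

    adj⇒consec : ∀ {i j} → i < suc (suc M) → j < suc (suc M) → cyc i ~ cyc j → Consec i j
    adj⇒consec {zero}  {zero}  _ _ a~a = ⊥-elim (~-irrefl a~a)
    adj⇒consec {zero}  {suc l} _ (s≤s (s≤s l≤M)) a~q with a-ends l≤M a~q
    ... | inj₁ refl = inj₁ refl
    ... | inj₂ refl = inj₂ (inj₂ (inj₁ (refl , refl)))
    adj⇒consec {suc k} {zero}  (s≤s (s≤s k≤M)) _ q~a with a-ends k≤M (~-sym q~a)
    ... | inj₁ refl = inj₂ (inj₁ refl)
    ... | inj₂ refl = inj₂ (inj₂ (inj₂ (refl , refl)))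
    adj⇒consec {suc k} {suc l} (s≤s (s≤s k≤M)) (s≤s (s≤s l≤M)) q~q with q-chordless k≤M l≤M q~q
    ... | inj₁ refl = inj₁ refl
    ... | inj₂ refl = inj₂ (inj₁ refl)

    consec⇒adj : ∀ {i j} → i < suc (suc M) → j < suc (suc M) → Consec i j → cyc i ~ cyc j
    consec⇒adj {zero}  {zero}  _ _ (inj₁ ())
    consec⇒adj {zero}  {zero}  _ _ (inj₂ (inj₁ ()))
    consec⇒adj {zero}  {zero}  _ _ (inj₂ (inj₂ (inj₁ (_ , ()))))
    consec⇒adj {zero}  {zero}  _ _ (inj₂ (inj₂ (inj₂ (_ , ()))))
    consec⇒adj {zero}  {suc _} _ _ (inj₁ refl)                       = a~q₀
    consec⇒adj {zero}  {suc _} _ _ (inj₂ (inj₂ (inj₁ (_ , refl))))   = a~q_M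
    consec⇒adj {suc _} {zero}  _ _ (inj₂ (inj₁ refl))                = ~-sym a~q₀
    consec⇒adj {suc _} {zero}  _ _ (inj₂ (inj₂ (inj₂ (_ , refl))))   = ~-sym a~q_M
    consec⇒adj {suc k} {suc _} _ (s≤s (s≤s k<M)) (inj₁ refl)         = q-edge k<M
    consec⇒adj {suc _} {suc l} (s≤s (s≤s l<M)) _ (inj₂ (inj₁ refl))  = ~-sym (q-edge l<M)
    consec⇒adj {suc _} {suc _} _ _ (inj₂ (inj₂ (inj₁ (() , _))))
    consec⇒adj {suc _} {suc _} _ _ (inj₂ (inj₂ (inj₂ (() , _))))

  private
    adjacent-indices : ∀ {k l} → l ≤ suc k → k ≤ suc l → k ≢ l → l ≡ suc k ⊎ k ≡ suc l
    adjacent-indices {k} {l} l≤1+k k≤1+l k≢l with <-cmp k l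
    ... | tri< k<l _ _ = inj₁ (≤-antisym l≤1+k k<l)
    ... | tri≈ _ k≡l _ = ⊥-elim (k≢l k≡l)
    ... | tri> _ _ l<k = inj₂ (≤-antisym k≤1+l l<k)

  -- A shortest walk from s₁ to s₂ through Y, closed up by a, would be an induced cycle
  -- of length at least 4.
  nonadjacent-neighbours-not-joined :
    ∀ {Y a s₁ s₂} → (∀ {x} → x ∈ₛ Y → x ≡ s₂ ⊎ ¬ N[ a ] x) →
    a ~ s₁ → a ~ s₂ → s₁ ≢ s₂ → ¬ s₁ ~ s₂ → s₂ ∉ₛ reach Y s₁
  nonadjacent-neighbours-not-joined {Y} {a} {s₁} {s₂} Y-avoids a~s₁ a~s₂ s₁≢s₂ s₁≁s₂ s₂∈
    with Layers.layer⇒exact {Y} {s₁} n s₂∈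
  ... | zero , _ , refl = s₁≢s₂ refl
  ... | suc zero , _ , exact with Layers.exact-pred {Y} {s₁} {0} exact
  ...   | _ , refl , s₁~s₂ = s₁≁s₂ s₁~s₂
  nonadjacent-neighbours-not-joined {Y} {a} {s₁} {s₂} Y-avoids a~s₁ a~s₂ s₁≢s₂ s₁≁s₂ s₂∈
    | M@(suc (suc _)) , _ , exact with Layers.exact-path {Y} {s₁} M exact
  ... | q , q_M≡s₂ , q-exact , q-edge =
    no-apex-over-induced-path M (s≤s (s≤s z≤n)) q q-injective q-chordless q-edge q≢a a-ends
      (subst (a ~_) (sym (q-exact z≤n)) a~s₁) (subst (a ~_) (sym q_M≡s₂) a~s₂)
    where
    open Layers {Y} {s₁}
    q-injective : ∀ {k l} → k ≤ M → l ≤ M → q k ≡ q l → k ≡ l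
    q-injective k≤M l≤M eq = exact-injective (q-exact k≤M) (subst (Exact _) (sym eq) (q-exact l≤M))
    q-chordless : ∀ {k l} → k ≤ M → l ≤ M → q k ~ q l → l ≡ suc k ⊎ k ≡ suc l
    q-chordless k≤M l≤M q~q =
      adjacent-indices (exact-adjacent (q-exact k≤M) (q-exact l≤M) q~q)
                       (exact-adjacent (q-exact l≤M) (q-exact k≤M) (~-sym q~q))
                       λ { refl → ~-irrefl q~q }
    q≢a : ∀ {k} → k ≤ M → q k ≢ a
    q≢a {zero} k≤M eq = ~⇒≢ a~s₁ (sym (trans (sym (q-exact k≤M)) eq))
    q≢a {suc k} k≤M eq with Y-avoids (exact-∈Y {k} (q-exact k≤M))
    ... | inj₁ q≡s₂ = ~⇒≢ a~s₂ (trans (sym eq) q≡s₂)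
    ... | inj₂ q∉N[a] = q∉N[a] (inj₁ eq)
    a-ends : ∀ {k} → k ≤ M → a ~ q k → k ≡ 0 ⊎ k ≡ M
    a-ends {zero} _ _ = inj₁ refl
    a-ends {suc k} k≤M a~q with Y-avoids (exact-∈Y {k} (q-exact k≤M))
    ... | inj₁ q≡s₂ = inj₂ (exact-injective (subst (Exact (suc k)) q≡s₂ (q-exact k≤M)) exact)
    ... | inj₂ q∉N[a] = ⊥-elim (q∉N[a] (inj₂ a~q))

  no-induced-C4 : ∀ {a b c d} → a ~ b → b ~ c → c ~ d → d ~ a → a ≢ c → b ≢ d → ¬ a ~ c → ¬ b ~ d → ⊥
  no-induced-C4 {a} {b} {c} {d} a~b b~c c~d d~a a≢c b≢d a≁c b≁d =
    nonadjacent-neighbours-not-joined Y-avoids a~b (~-sym d~a) b≢d b≁d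
      (reach-closed (reach-closed reach-seed (x∈p∪q⁺ (inj₁ (x∈⁅x⁆ c))) b~c) (x∈p∪q⁺ (inj₂ (x∈⁅x⁆ d))) c~d)
    where
    Y-avoids : ∀ {x} → x ∈ₛ ⁅ c ⁆ ∪ ⁅ d ⁆ → x ≡ d ⊎ ¬ N[ a ] x
    Y-avoids x∈ with x∈p∪q⁻ ⁅ c ⁆ ⁅ d ⁆ x∈
    ... | inj₂ x∈⁅d⁆ = inj₁ (x∈⁅y⁆⇒x≡y d x∈⁅d⁆)
    ... | inj₁ x∈⁅c⁆ rewrite x∈⁅y⁆⇒x≡y c x∈⁅c⁆ = inj₂ λ { (inj₁ c≡a) → a≢c (sym c≡a) ; (inj₂ a~c) → a≁c a~c }

  SimplicialIn : Subset n → Fin n → Set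
  SimplicialIn X w = ∀ {x y} → x ∈ₛ X → y ∈ₛ X → w ~ x → w ~ y → x ≢ y → x ~ y

  NonadjacentPairIn : Subset n → Set
  NonadjacentPairIn X = ∃[ u ] ∃[ v ] (u ∈ₛ X × v ∈ₛ X × ¬ N[ u ] v)

  nonadjacentPairIn? : ∀ X → Dec (NonadjacentPairIn X)
  nonadjacentPairIn? X = any? λ u → any? λ v → (u ∈ₛ? X) ×-dec (v ∈ₛ? X) ×-dec ¬? (N[ u ]? v)

  no-nonadjacentPair⇒clique : ∀ {X} → ¬ NonadjacentPairIn X → ∀ {x y} → x ∈ₛ X → y ∈ₛ X → x ≢ y → x ~ y
  no-nonadjacentPair⇒clique no-pair {x} {y} x∈X y∈X x≢y = decidable-stable (x ~? y) λ x≁y →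
    no-pair (x , y , x∈X , y∈X , ∉N[] (λ y≡x → x≢y (sym y≡x)) x≁y)

  -- B is the component of b in X ∖ N[a] and S its neighbourhood in X; S ⊆ N(a) is a clique.
  module Separation {X : Subset n} {a b : Fin n} (a∈X : a ∈ₛ X) (b∈X : b ∈ₛ X) (b∉N[a] : ¬ N[ a ] b) where

    avoiding? : Decidable (λ x → x ∈ₛ X × ¬ N[ a ] x)
    avoiding? x = (x ∈ₛ? X) ×-dec ¬? (N[ a ]? x)

    Y : Subset n
    Y = ⟦ avoiding? ⟧

    B : Subset n
    B = reach Y b

    Attached : Fin n → Set
    Attached x = (x ∈ₛ X × x ∉ₛ B) × ∃[ y ] (y ∈ₛ B × x ~ y)

    attached? : Decidable Attached
    attached? x = ((x ∈ₛ? X) ×-dec ¬? (x ∈ₛ? B)) ×-dec any? (λ y → (y ∈ₛ? B) ×-dec (x ~? y))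

    S : Subset n
    S = ⟦ attached? ⟧

    X₁ : Subset n
    X₁ = B ∪ S

    B⊆X∖N[a] : ∀ {x} → x ∈ₛ B → x ∈ₛ X × ¬ N[ a ] x
    B⊆X∖N[a] x∈B with reach-⊆ x∈B
    ... | inj₁ refl = b∈X , b∉N[a]
    ... | inj₂ x∈Y = ∈⟦⟧⁻ avoiding? x∈Y

    S⊆N⟨a⟩ : ∀ {s} → s ∈ₛ S → a ~ s
    S⊆N⟨a⟩ {s} s∈S with ∈⟦⟧⁻ attached? s∈S
    ... | (s∈X , s∉B) , y , y∈B , s~y with N[ a ]? s
    ...   | yes (inj₂ a~s) = a~s
    ...   | yes (inj₁ refl) = ⊥-elim (proj₂ (B⊆X∖N[a] y∈B) (inj₂ s~y))
    ...   | no s∉N[a] = ⊥-elim (s∉B (reach-closed y∈B (∈⟦⟧⁺ avoiding? (s∈X , s∉N[a])) (~-sym s~y)))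

    S-clique : ∀ {s₁ s₂} → s₁ ∈ₛ S → s₂ ∈ₛ S → s₁ ≢ s₂ → s₁ ~ s₂
    S-clique {s₁} {s₂} s₁∈S s₂∈S s₁≢s₂ with ∈⟦⟧⁻ attached? s₁∈S | ∈⟦⟧⁻ attached? s₂∈S
    ... | _ , y₁ , y₁∈B , s₁~y₁ | _ , y₂ , y₂∈B , s₂~y₂ = decidable-stable (s₁ ~? s₂) λ s₁≁s₂ →
      nonadjacent-neighbours-not-joined avoids (S⊆N⟨a⟩ s₁∈S) (S⊆N⟨a⟩ s₂∈S) s₁≢s₂ s₁≁s₂ joined
      where
      avoids : ∀ {x} → x ∈ₛ B ∪ ⁅ s₂ ⁆ → x ≡ s₂ ⊎ ¬ N[ a ] x
      avoids x∈ with x∈p∪q⁻ B ⁅ s₂ ⁆ x∈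
      ... | inj₁ x∈B = inj₂ (proj₂ (B⊆X∖N[a] x∈B))
      ... | inj₂ x∈⁅s₂⁆ = inj₁ (x∈⁅y⁆⇒x≡y s₂ x∈⁅s₂⁆)
      y₂-joined : y₂ ∈ₛ reach (B ∪ ⁅ s₂ ⁆) s₁
      y₂-joined = reach-trans (reach-closed reach-seed (x∈p∪q⁺ (inj₁ y₁∈B)) s₁~y₁)
                              (reach-mono (p⊆p∪q ⁅ s₂ ⁆) (reach-connected y₁∈B y₂∈B))
      joined : s₂ ∈ₛ reach (B ∪ ⁅ s₂ ⁆) s₁
      joined = reach-closed y₂-joined (x∈p∪q⁺ (inj₂ (x∈⁅x⁆ s₂))) (~-sym s₂~y₂)

    X₁⊂X : X₁ ⊂ X
    X₁⊂X = X₁⊆X , a , a∈X , a∉X₁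
      where
      X₁⊆X : X₁ ⊆ X
      X₁⊆X x∈X₁ with x∈p∪q⁻ B S x∈X₁
      ... | inj₁ x∈B = proj₁ (B⊆X∖N[a] x∈B)
      ... | inj₂ x∈S = proj₁ (proj₁ (∈⟦⟧⁻ attached? x∈S))
      a∉X₁ : a ∉ₛ X₁
      a∉X₁ a∈X₁ with x∈p∪q⁻ B S a∈X₁
      ... | inj₁ a∈B = proj₂ (B⊆X∖N[a] a∈B) (inj₁ refl)
      ... | inj₂ a∈S = ~-irrefl (S⊆N⟨a⟩ a∈S)

    B-neighbours⊆X₁ : ∀ {w x} → w ∈ₛ B → x ∈ₛ X → w ~ x → x ∈ₛ X₁
    B-neighbours⊆X₁ {w} {x} w∈B x∈X w~x with x ∈ₛ? B
    ... | yes x∈B = x∈p∪q⁺ (inj₁ x∈B)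
    ... | no x∉B = x∈p∪q⁺ (inj₂ (∈⟦⟧⁺ attached? ((x∈X , x∉B) , w , w∈B , ~-sym w~x)))

    simplicial-lift : ∀ {w} → w ∈ₛ B → SimplicialIn X₁ w → SimplicialIn X w
    simplicial-lift w∈B simplicial x∈X y∈X w~x w~y =
      simplicial (B-neighbours⊆X₁ w∈B x∈X w~x) (B-neighbours⊆X₁ w∈B y∈X w~y) w~x w~y

    -- Take a′ ∈ S if some vertex of S has a non-neighbour in X₁: the clique S then lies in N[a′].
    -- Otherwise every vertex of S is adjacent to all of X₁, so lies in N[a′] anyway.
    pivot : NonadjacentPairIn X₁ →
            ∃[ a′ ] ∃[ b′ ] (a′ ∈ₛ X₁ × b′ ∈ₛ X₁ × ¬ N[ a′ ] b′ × (∀ {w} → w ∈ₛ X₁ → ¬ N[ a′ ] w → w ∈ₛ B))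
    pivot (u , v , u∈X₁ , v∈X₁ , v∉N[u])
      with any? (λ s → any? (λ v → (s ∈ₛ? S) ×-dec (v ∈ₛ? X₁) ×-dec ¬? (N[ s ]? v)))
    ... | yes (s , v′ , s∈S , v′∈X₁ , v′∉N[s]) = s , v′ , x∈p∪q⁺ (inj₂ s∈S) , v′∈X₁ , v′∉N[s] , outside
      where
      outside : ∀ {w} → w ∈ₛ X₁ → ¬ N[ s ] w → w ∈ₛ B
      outside w∈X₁ w∉N[s] with x∈p∪q⁻ B S w∈X₁
      ... | inj₁ w∈B = w∈B
      ... | inj₂ w∈S = ⊥-elim (w∉N[s] (inj₂ (S-clique s∈S w∈S λ { refl → w∉N[s] (inj₁ refl) })))
    ... | no none = u , v , u∈X₁ , v∈X₁ , v∉N[u] , outside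
      where
      outside : ∀ {w} → w ∈ₛ X₁ → ¬ N[ u ] w → w ∈ₛ B
      outside {w} w∈X₁ w∉N[u] with x∈p∪q⁻ B S w∈X₁
      ... | inj₁ w∈B = w∈B
      ... | inj₂ w∈S = ⊥-elim (none (w , u , w∈S , u∈X₁ , λ u∈N[w] → w∉N[u] (N[]-sym u∈N[w])))

  -- Dirac's lemma, by well-founded induction: the simplicial vertex is found inside X₁ ⊂ X.
  simplicial-outside : ∀ X → Acc _⊂_ X → ∀ {a b} → a ∈ₛ X → b ∈ₛ X → ¬ N[ a ] b →
                       ∃[ w ] (w ∈ₛ X × ¬ N[ a ] w × SimplicialIn X w)
  simplicial-outside X (acc smaller) {a} {b} a∈X b∈X b∉N[a] = found
    where
    open Separation a∈X b∈X b∉N[a]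
    found : ∃[ w ] (w ∈ₛ X × ¬ N[ a ] w × SimplicialIn X w)
    found with nonadjacentPairIn? X₁
    ... | no no-pair =
      b , b∈X , b∉N[a] , simplicial-lift reach-seed λ x∈ y∈ _ _ → no-nonadjacentPair⇒clique no-pair x∈ y∈
    ... | yes pair with pivot pair
    ...   | a′ , b′ , a′∈X₁ , b′∈X₁ , b′∉N[a′] , outside-a′⊆B
      with simplicial-outside X₁ (smaller X₁⊂X) a′∈X₁ b′∈X₁ b′∉N[a′]
    ...     | w , w∈X₁ , w∉N[a′] , simplicial =
      let w∈B = outside-a′⊆B w∈X₁ w∉N[a′] in
      w , proj₁ (B⊆X∖N[a] w∈B) , proj₂ (B⊆X∖N[a] w∈B) , simplicial-lift w∈B simplicial

  simplicial-in : ∀ X {x} → x ∈ₛ X → ∃[ w ] (w ∈ₛ X × SimplicialIn X w)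
  simplicial-in X {x} x∈X with nonadjacentPairIn? X
  ... | yes (a , b , a∈X , b∈X , b∉N[a]) =
    let w , w∈X , _ , simplicial = simplicial-outside X (⊂-wellFounded X) a∈X b∈X b∉N[a] in w , w∈X , simplicial
  ... | no no-pair = x , x∈X , λ y∈ z∈ _ _ → no-nonadjacentPair⇒clique no-pair y∈ z∈

  component-simplicial : ∀ v → ∃[ w ] (Simplicial w × v ∈ₛ reach ⊤ₛ w)
  component-simplicial v =
    let w , w∈C , simplicial = simplicial-in (reach ⊤ₛ v) reach-seed in
    w , (λ w~x w~y → simplicial (reach-closed w∈C ∈⊤ w~x) (reach-closed w∈C ∈⊤ w~y) w~x w~y) ,
    reach-sym ∈⊤ w∈C

module Decomposition {n : ℕ} (G : Graph n) {k : ℕ} (tu : TotalUniform G k) (ni : NoIsolated G) (ch : Chordal G) where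

  open Neighbourhoods G
  open TotalUniformity G tu ni
  open Chordality G ch using (component-simplicial; no-induced-C4)
  open Connectivity G using (reach-⊆-closed)

  -- t is a neighbour of a simplicial vertex in the component of v
  central : ∀ v → ∃[ t ] (AdjClosed N[ t ] × N[ t ] v)
  central v =
    let w , simplicial , v∈C = component-simplicial v
        t , w~t = ni w
        closed = simplicial-neighbour-closed simplicial w~t
    in t , closed , reach-⊆-closed closed (inj₂ (~-sym w~t)) v∈C

  record Centres : Set where
    field
      count    : ℕ
      centre   : Fin count → Fin n
      closed   : ∀ i → AdjClosed N[ centre i ]
      disjoint : ∀ {i j x} → N[ centre i ] x → N[ centre j ] x → i ≡ j

    Covered : Fin n → Set
    Covered v = ∃[ i ] N[ centre i ] v

  open Centres

  add-centre : (C : Centres) → ∀ {v} → ¬ Covered C v →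
               Σ Centres λ C′ → Covered C′ v × (∀ {x} → Covered C x → Covered C′ x)
  add-centre C {v} v-uncovered with central v
  ... | t , t-closed , v∈N[t] = C′ , (fzero , v∈N[t]) , λ (i , x∈) → fsuc i , x∈
    where
    apart : ∀ j {x} → N[ t ] x → N[ centre C j ] x → ⊥
    apart j x∈N[t] x∈N[cⱼ] = v-uncovered (j , overlap⇒N[]⊆ (closed C j) x∈N[t] x∈N[cⱼ] v∈N[t])
    centre′ : Fin (suc (count C)) → Fin n
    centre′ fzero = t
    centre′ (fsuc i) = centre C i
    closed′ : ∀ i → AdjClosed N[ centre′ i ]
    closed′ fzero = t-closed
    closed′ (fsuc i) = closed C i
    disjoint′ : ∀ {i j x} → N[ centre′ i ] x → N[ centre′ j ] x → i ≡ j
    disjoint′ {fzero}  {fzero}  _   _   = refl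
    disjoint′ {fzero}  {fsuc j} x∈t x∈j = ⊥-elim (apart j x∈t x∈j)
    disjoint′ {fsuc i} {fzero}  x∈i x∈t = ⊥-elim (apart i x∈t x∈i)
    disjoint′ {fsuc i} {fsuc j} x∈i x∈j = cong fsuc (disjoint C x∈i x∈j)
    C′ : Centres
    C′ = record { count = suc (count C) ; centre = centre′ ; closed = closed′ ; disjoint = disjoint′ }

  covering : ∀ vs → Σ Centres λ C → All (Covered C) vs
  covering [] = record { count = 0 ; centre = λ () ; closed = λ () ; disjoint = λ { {()} } } , []
  covering (v ∷ vs) with covering vs
  ... | C , covered with any? (λ i → N[ centre C i ]? v)
  ...   | yes v-covered = C , v-covered ∷ covered
  ...   | no v-uncovered =
    let C′ , v-covered , extends = add-centre C v-uncovered in C′ , v-covered ∷ All.map extends covered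

  centres : Centres
  centres = proj₁ (covering (allFin n))

  open Centres centres using () renaming (count to r; centre to c; closed to c-closed; disjoint to c-disjoint)

  component : Fin n → Fin r
  component v = proj₁ (All.lookup (proj₂ (covering (allFin n))) (∈-allFin v))

  in-component : ∀ v → N[ c (component v) ] v
  in-component v = proj₂ (All.lookup (proj₂ (covering (allFin n))) (∈-allFin v))

  component-unique : ∀ {i x} → N[ c i ] x → component x ≡ i
  component-unique x∈ = c-disjoint (in-component _) x∈

  ~⇒same-component : ∀ {u v} → u ~ v → component u ≡ component v
  ~⇒same-component {u} u~v = sym (component-unique (c-closed (component u) (in-component u) u~v))

  nested : ∀ {u v} → component u ≡ component v → ¬ N[ u ] v → ∀ {x} → u ~ x → v ~ x
  nested {u} {v} same =
    nonadjacent-nested (c-closed (component u)) (in-component u) (subst (λ i → N[ c i ] v) (sym same) (in-component v))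

  -- the vertices forming the (unique) part of size > 1 of their component
  HasNonNeighbour : Fin n → Set
  HasNonNeighbour v = ∃[ u ] (component u ≡ component v × ¬ N[ u ] v)

  hasNonNeighbour? : ∀ v → Dec (HasNonNeighbour v)
  hasNonNeighbour? v = any? λ u → (component u ≟F component v) ×-dec ¬? (N[ u ]? v)

  -- u v u′ v′ would be an induced 4-cycle
  hasNonNeighbour-independent : ∀ {u v} → u ~ v → HasNonNeighbour u → HasNonNeighbour v → ⊥
  hasNonNeighbour-independent {u} {v} u~v (u′ , same-u , u∉N[u′]) (v′ , same-v , v∉N[v′]) =
    no-induced-C4 u~v (~-sym u′~v) u′~v′ v′~u
      (λ { refl → u∉N[u′] (inj₁ refl) }) (λ { refl → v∉N[v′] (inj₁ refl) })
      (λ u~u′ → u∉N[u′] (inj₂ (~-sym u~u′))) (λ v~v′ → v∉N[v′] (inj₂ (~-sym v~v′)))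
    where
    u′∉N[u] : ¬ N[ u ] u′
    u′∉N[u] u′∈N[u] = u∉N[u′] (N[]-sym u′∈N[u])
    v′∉N[v] : ¬ N[ v ] v′
    v′∉N[v] v′∈N[v] = v∉N[v′] (N[]-sym v′∈N[v])
    u′~v : u′ ~ v
    u′~v = nested (sym same-u) u′∉N[u] u~v
    v′~u : v′ ~ u
    v′~u = nested (sym same-v) v′∉N[v] (~-sym u~v)
    u′~v′ : u′ ~ v′
    u′~v′ = ~-sym (nested (sym same-v) v′∉N[v] (~-sym u′~v))

  -- Every other vertex forms a part of its own, labelled by its index (which is < n).
  label : ∀ v → Dec (HasNonNeighbour v) → ℕ
  label v (yes _) = n
  label v (no _)  = toℕ v

  part : Fin n → ℕ
  part v = label v (hasNonNeighbour? v)

  part-cases : ∀ v → (HasNonNeighbour v × part v ≡ n) ⊎ (¬ HasNonNeighbour v × part v ≡ toℕ v)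
  part-cases v with hasNonNeighbour? v
  ... | yes big = inj₁ (big , refl)
  ... | no small = inj₂ (small , refl)

  n≢toℕ : ∀ v → n ≢ toℕ v
  n≢toℕ v n≡v = <-irrefl (sym n≡v) (toℕ<n v)

  big⇒part≡n : ∀ {v} → HasNonNeighbour v → part v ≡ n
  big⇒part≡n {v} big with part-cases v
  ... | inj₁ (_ , pv) = pv
  ... | inj₂ (small , _) = ⊥-elim (small big)

  part≡n⇒big : ∀ {v} → part v ≡ n → HasNonNeighbour v
  part≡n⇒big {v} pv≡n with part-cases v
  ... | inj₁ (big , _) = big
  ... | inj₂ (_ , pv) = ⊥-elim (n≢toℕ v (trans (sym pv≡n) pv))

  shared-part⇒n : ∀ {u u′} → part u ≡ part u′ → u ≢ u′ → part u ≡ n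
  shared-part⇒n {u} {u′} same u≢u′ with part-cases u | part-cases u′
  ... | inj₁ (_ , pu) | _ = pu
  ... | inj₂ (_ , pu) | inj₁ (_ , pu′) = ⊥-elim (n≢toℕ u (trans (sym pu′) (trans (sym same) pu)))
  ... | inj₂ (_ , pu) | inj₂ (_ , pu′) = ⊥-elim (u≢u′ (toℕ-injective (trans (sym pu) (trans same pu′))))

  ~⇒parts-differ : ∀ {u v} → u ~ v → part u ≢ part v
  ~⇒parts-differ u~v same = hasNonNeighbour-independent u~v
    (part≡n⇒big (shared-part⇒n same (~⇒≢ u~v)))
    (part≡n⇒big (shared-part⇒n (sym same) (~⇒≢ (~-sym u~v))))

  parts-differ⇒~ : ∀ {u v} → component u ≡ component v → part u ≢ part v → u ~ v
  parts-differ⇒~ {u} {v} same differ = decidable-stable (u ~? v) λ u≁v → differ (nonadjacent⇒same-part u≁v)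
    where
    nonadjacent⇒same-part : ¬ u ~ v → part u ≡ part v
    nonadjacent⇒same-part u≁v with u ≟F v
    ... | yes refl = refl
    ... | no u≢v = trans (big⇒part≡n (v , sym same , ∉N[] u≢v (λ v~u → u≁v (~-sym v~u))))
                         (sym (big⇒part≡n (u , same , ∉N[] (λ v≡u → u≢v (sym v≡u)) u≁v)))

  union : UnionOfCMP G r
  union = component , part ,
    (λ u v → (λ u~v → ~⇒same-component u~v , ~⇒parts-differ u~v) , λ (same , differ) → parts-differ⇒~ same differ) ,
    (λ i → let t~w = proj₂ (ni (c i)) in
           c i , proj₁ (ni (c i)) , component-unique (inj₁ refl) , component-unique (inj₂ t~w) ,
           ~⇒parts-differ t~w) ,
    λ _ _ _ _ _ _ _ pu≡pu′ u≢u′ pv≡pv′ v≢v′ → trans (shared-part⇒n pu≡pu′ u≢u′) (sym (shared-part⇒n pv≡pv′ v≢v′))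

module FromUnion {n : ℕ} (G : Graph n) {r : ℕ} (U : UnionOfCMP G r) where

  open Neighbourhoods G
  open Legality G using (LegalStep)

  component : Fin n → Fin r
  component = proj₁ U

  part : Fin n → ℕ
  part = proj₁ (proj₂ U)

  adjacency : ∀ u v → (u ~ v → component u ≡ component v × part u ≢ part v) ×
                       (component u ≡ component v × part u ≢ part v → u ~ v)
  adjacency = proj₁ (proj₂ (proj₂ U))

  two-parts : ∀ i → ∃[ u ] ∃[ v ] (component u ≡ i × component v ≡ i × part u ≢ part v)
  two-parts = proj₁ (proj₂ (proj₂ (proj₂ U)))

  open FibreCounting component

  ~⇒same-component : ∀ {u v} → u ~ v → component u ≡ component v
  ~⇒same-component {u} {v} u~v = proj₁ (proj₁ (adjacency u v) u~v)

  ~⇒parts-differ : ∀ {u v} → u ~ v → part u ≢ part v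
  ~⇒parts-differ {u} {v} u~v = proj₂ (proj₁ (adjacency u v) u~v)

  parts-differ⇒~ : ∀ {u v} → component u ≡ component v → part u ≢ part v → u ~ v
  parts-differ⇒~ {u} {v} same differ = proj₂ (adjacency u v) (same , differ)

  nonadjacent⇒same-part : ∀ {u v} → component u ≡ component v → ¬ u ~ v → part u ≡ part v
  nonadjacent⇒same-part {u} {v} same u≁v = decidable-stable (part u ≟ part v) λ differ →
    u≁v (parts-differ⇒~ same differ)

  one-big-part : ∀ {u u′ v v′} → component u ≡ component v → component u ≡ component u′ →
                 component v ≡ component v′ → part u ≡ part u′ → u ≢ u′ → part v ≡ part v′ → v ≢ v′ →
                 part u ≡ part v
  one-big-part = proj₂ (proj₂ (proj₂ (proj₂ U))) _ _ _ _

  -- {a , c} and {b , d} would lie in two different parts of size > 1 of one component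
  no-induced-P₄ : ∀ {a b c d} → a ~ b → b ~ c → c ~ d → a ≢ c → b ≢ d → ¬ a ~ c → ¬ b ~ d → ⊥
  no-induced-P₄ {a} {b} {c} {d} a~b b~c c~d a≢c b≢d a≁c b≁d =
    ~⇒parts-differ a~b (one-big-part (~⇒same-component a~b) same-ac same-bd
      (nonadjacent⇒same-part same-ac a≁c) a≢c (nonadjacent⇒same-part same-bd b≁d) b≢d)
    where
    same-ac : component a ≡ component c
    same-ac = trans (~⇒same-component a~b) (~⇒same-component b~c)
    same-bd : component b ≡ component d
    same-bd = trans (~⇒same-component b~c) (~⇒same-component c~d)

  chordal : Chordal G
  chordal (suc (suc (suc (suc m)))) (s≤s (s≤s (s≤s (s≤s _)))) cyc (injective , adjacency) =
    no-induced-P₄ (edge 0F 1F refl) (edge 1F 2F refl) (edge 2F 3F refl)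
      (λ eq → 0≢2 (injective eq)) (λ eq → 1≢3 (injective eq)) 0≁2 1≁3
    where
    0F 1F 2F 3F : Fin (suc (suc (suc (suc m))))
    0F = fzero
    1F = fsuc fzero
    2F = fsuc (fsuc fzero)
    3F = fsuc (fsuc (fsuc fzero))
    edge : ∀ i j → toℕ j ≡ suc (toℕ i) → cyc i ~ cyc j
    edge i j j≡1+i = proj₂ (adjacency i j) (inj₁ j≡1+i)
    0≢2 : 0F ≢ 2F
    0≢2 ()
    1≢3 : 1F ≢ 3F
    1≢3 ()
    0≁2 : ¬ cyc 0F ~ cyc 2F
    0≁2 c₀~c₂ with proj₁ (adjacency 0F 2F) c₀~c₂
    ... | inj₁ ()
    ... | inj₂ (inj₁ ())
    ... | inj₂ (inj₂ (inj₁ (_ , ())))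
    ... | inj₂ (inj₂ (inj₂ (() , _)))
    1≁3 : ¬ cyc 1F ~ cyc 3F
    1≁3 c₁~c₃ with proj₁ (adjacency 1F 3F) c₁~c₃
    ... | inj₁ ()
    ... | inj₂ (inj₁ ())
    ... | inj₂ (inj₂ (inj₁ (() , _)))
    ... | inj₂ (inj₂ (inj₂ (() , _)))

  u v : Fin r → Fin n
  u i = proj₁ (two-parts i)
  v i = proj₁ (proj₂ (two-parts i))

  u∈ : ∀ i → component (u i) ≡ i
  u∈ i = proj₁ (proj₂ (proj₂ (two-parts i)))

  v∈ : ∀ i → component (v i) ≡ i
  v∈ i = proj₁ (proj₂ (proj₂ (proj₂ (two-parts i))))

  u-v-parts-differ : ∀ i → part (u i) ≢ part (v i)
  u-v-parts-differ i = proj₂ (proj₂ (proj₂ (proj₂ (two-parts i))))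

  u~v : ∀ i → u i ~ v i
  u~v i = parts-differ⇒~ (trans (u∈ i) (sym (v∈ i))) (u-v-parts-differ i)

  pairs : List (Fin r) → List (Fin n)
  pairs []       = []
  pairs (i ∷ is) = u i ∷ v i ∷ pairs is

  pairs-length : ∀ is → length (pairs is) ≡ length is * 2
  pairs-length []       = refl
  pairs-length (i ∷ is) = cong (λ l → suc (suc l)) (pairs-length is)

  pairs-component : ∀ {x} is → x ∈ pairs is → component x ∈ is
  pairs-component (i ∷ is) (here refl)         = here (u∈ i)
  pairs-component (i ∷ is) (there (here refl)) = here (v∈ i)
  pairs-component (i ∷ is) (there (there x∈))  = there (pairs-component is x∈)

  pairs-complete : ∀ {i is} → i ∈ is → u i ∈ pairs is × v i ∈ pairs is
  pairs-complete (here refl) = here refl , there (here refl)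
  pairs-complete (there i∈)  = let u∈ , v∈ = pairs-complete i∈ in there (there u∈) , there (there v∈)

  fresh : ∀ {i is x} → All (i ≢_) is → component x ≡ i → component x ∉ is
  fresh i∉is refl x∈is = All.lookup i∉is x∈is refl

  pairs-unique : ∀ is → Unique is → Unique (pairs is)
  pairs-unique []       _              = []
  pairs-unique (i ∷ is) (i∉is ∷ is!) =
    ((λ eq → u-v-parts-differ i (cong part eq)) ∷ All.tabulate (λ x∈ eq → apart (u∈ i) x∈ eq))
    ∷ All.tabulate (λ x∈ eq → apart (v∈ i) x∈ eq) ∷ pairs-unique is is!
    where
    apart : ∀ {y x} → component y ≡ i → x ∈ pairs is → y ≢ x
    apart y∈i x∈ refl = fresh i∉is y∈i (pairs-component is x∈)

  -- u i is legal through v i, and v i through u i: nothing earlier lies in component i.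
  pairs-legal : ∀ prev is → Unique is → All (λ x → component x ∉ is) prev → LegalFrom G prev (pairs is)
  pairs-legal prev []       _             _     = tt
  pairs-legal prev (i ∷ is) (i∉is ∷ is!) outside =
    inj₂ (v i , u~v i , All.map (λ x∉ x~v → x∉ (here (trans (~⇒same-component x~v) (v∈ i)))) outside) ,
    inj₂ (u i , ~-sym (u~v i) ,
          All-++⁺ (All.map (λ x∉ x~u → x∉ (here (trans (~⇒same-component x~u) (u∈ i)))) outside) (~-irrefl ∷ [])) ,
    pairs-legal ((prev ++ [ u i ]) ++ [ v i ]) is is!
      (All-++⁺ (All-++⁺ (All.map (λ x∉ x∈ → x∉ (there x∈)) outside) (fresh i∉is (u∈ i) ∷ []))
               (fresh i∉is (v∈ i) ∷ []))

  witnesses : List (Fin n)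
  witnesses = pairs (allFin r)

  witnesses-length : length witnesses ≡ r * 2
  witnesses-length = trans (pairs-length (allFin r)) (cong (_* 2) (length-tabulate {n = r} (λ i → i)))

  witnesses-dominating : Dominates G witnesses
  witnesses-dominating x with part x ≟ part (u (component x))
  ... | no differ = u (component x) , proj₁ (pairs-complete (∈-allFin _)) , parts-differ⇒~ (sym (u∈ _)) differ
  ... | yes same = v (component x) , proj₂ (pairs-complete (∈-allFin _)) ,
                   parts-differ⇒~ (sym (v∈ _)) (λ eq → u-v-parts-differ _ (trans (sym same) eq))

  witnesses-TDSeq : IsTDSeq G witnesses
  witnesses-TDSeq = (pairs-unique (allFin r) (allFin⁺ r) , pairs-legal [] (allFin r) (allFin⁺ r) []) ,
                    witnesses-dominating

  -- a neighbour a ∈ A of u i, and a neighbour of a in A, both lie in component i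
  tds-lower : ∀ A → IsTDS G A → r * 2 ≤ length A
  tds-lower A (_ , dominating) = ≤length A λ i →
    let a , a∈A , u~a = dominating (u i)
        a′ , a′∈A , a~a′ = dominating a
        a∈i = trans (sym (~⇒same-component u~a)) (u∈ i)
    in two-in-fibre A a∈A a′∈A a∈i (trans (sym (~⇒same-component a~a′)) a∈i) (~⇒≢ a~a′)

  EarlierInComponent : List (Fin n) → Fin n → Fin n → Set
  EarlierInComponent prev z x = x ∈ prev × component x ≡ component z

  -- the vertex w certifying the legal step of z is a non-neighbour of all earlier vertices
  earlier-part≢ : ∀ {prev z x} → LegalStep prev z → EarlierInComponent prev z x → part x ≢ part z
  earlier-part≢ (inj₁ refl) (() , _)
  earlier-part≢ (inj₂ (w , z~w , w-new)) (x∈ , same) eq =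
    ~⇒parts-differ z~w (trans (sym eq)
      (nonadjacent⇒same-part (trans same (~⇒same-component z~w)) (All.lookup w-new x∈)))

  earlier-parts-equal : ∀ {prev z x y} → LegalStep prev z →
                        EarlierInComponent prev z x → EarlierInComponent prev z y → part x ≡ part y
  earlier-parts-equal (inj₁ refl) (() , _) _
  earlier-parts-equal (inj₂ (w , z~w , w-new)) (x∈ , x-same) (y∈ , y-same) =
    trans (nonadjacent⇒same-part (trans x-same (~⇒same-component z~w)) (All.lookup w-new x∈))
          (sym (nonadjacent⇒same-part (trans y-same (~⇒same-component z~w)) (All.lookup w-new y∈)))

  -- what a legal sequence can contain from one component
  Admissible : List (Fin n) → Set
  Admissible []              = ⊤
  Admissible (_ ∷ [])        = ⊤
  Admissible (x ∷ y ∷ [])    = part x ≢ part y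
  Admissible (_ ∷ _ ∷ _ ∷ _) = ⊥

  admissible-length : ∀ F → Admissible F → length F ≤ 2
  admissible-length []           _ = z≤n
  admissible-length (_ ∷ [])     _ = s≤s z≤n
  admissible-length (_ ∷ _ ∷ []) _ = s≤s (s≤s z≤n)

  admissible-∷ʳ : ∀ i prev z → Admissible (fibre i prev) → LegalStep prev z → Admissible (fibre i (prev ++ [ z ]))
  admissible-∷ʳ i prev z admissible step rewrite filter-++ (λ x → component x ≟F i) prev [ z ] with component z ≟F i
  ... | no _ = subst Admissible (sym (++-identityʳ _)) admissible
  ... | yes z∈i = extend (fibre i prev) fibre⇒earlier admissible
    where
    fibre⇒earlier : ∀ {x} → x ∈ fibre i prev → EarlierInComponent prev z x
    fibre⇒earlier x∈ = let x∈prev , x∈i = ∈-filter⁻ (λ x → component x ≟F i) {xs = prev} x∈ in x∈prev , trans x∈i (sym z∈i)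
    extend : ∀ F → (∀ {x} → x ∈ F → EarlierInComponent prev z x) → Admissible F → Admissible (F ++ [ z ])
    extend []           _       _   = tt
    extend (x ∷ [])     earlier _   = earlier-part≢ step (earlier (here refl))
    extend (x ∷ y ∷ []) earlier x≢y = x≢y (earlier-parts-equal step (earlier (here refl)) (earlier (there (here refl))))

  admissible-++ : ∀ i prev rest → Admissible (fibre i prev) → LegalFrom G prev rest → Admissible (fibre i (prev ++ rest))
  admissible-++ i prev []         admissible _ = subst (λ s → Admissible (fibre i s)) (sym (++-identityʳ prev)) admissible
  admissible-++ i prev (z ∷ rest) admissible (step , legal) =
    subst (λ s → Admissible (fibre i s)) (++-assoc prev [ z ] rest)
      (admissible-++ i (prev ++ [ z ]) rest (admissible-∷ʳ i prev z admissible step) legal)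

  legal-upper : ∀ s → Legal G s → length s ≤ r * 2
  legal-upper s (_ , legal) = length≤ s λ i → admissible-length _ (admissible-++ i [] s tt legal)

  totalUniform : TotalUniform G (r * 2)
  totalUniform = ((witnesses , (proj₁ (proj₁ witnesses-TDSeq) , witnesses-dominating) , witnesses-length) , tds-lower) ,
                 ((witnesses , witnesses-TDSeq , witnesses-length) , λ s seq → legal-upper s (proj₁ seq))

theorem5p3 : {n : ℕ} (G : Graph n) → NoIsolated G → (k : ℕ) → 1 ≤ k →
    (TotalUniform G k × Chordal G) ⇔ (k % 2 ≡ 0 × UnionOfCMP G (k / 2))
theorem5p3 G ni k _ = mk⇔ forward backward
  where
  forward : TotalUniform G k × Chordal G → k % 2 ≡ 0 × UnionOfCMP G (k / 2)
  forward (tu , ch) = halve (Decomposition.union G tu ni ch)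
    where
    halve : ∀ {r} → UnionOfCMP G r → k % 2 ≡ 0 × UnionOfCMP G (k / 2)
    halve {r} U = subst (λ m → m % 2 ≡ 0) (sym k≡r*2) (m*n%n≡0 r 2) ,
                  subst (UnionOfCMP G) (sym (trans (cong (_/ 2) k≡r*2) (m*n/n≡m r 2))) U
      where
      k≡r*2 : k ≡ r * 2
      k≡r*2 = GammaT-unique {G = G} (proj₁ tu) (proj₁ (FromUnion.totalUniform G U))
  backward : k % 2 ≡ 0 × UnionOfCMP G (k / 2) → TotalUniform G k × Chordal G
  backward (even , U) = subst (TotalUniform G) (sym k≡k/2*2) (FromUnion.totalUniform G U) , FromUnion.chordal G U
    where
    k≡k/2*2 : k ≡ k / 2 * 2
    k≡k/2*2 = trans (m≡m%n+[m/n]*n k 2) (cong (_+ k / 2 * 2) even)
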